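{- Let $\phi=\frac{1+\sqrt5}2$ and $n,m\in\mathbb{Z}_{\geq0}$. If $\lfloor n\phi\rfloor-2\le\lfloor m(\phi+1)\rfloor\le\lfloor n\phi\rfloor-1$, then $m=\lfloor n/\phi\rfloor$. -}

module Defs where

open import Data.Integer using (ℤ; +_; _+_; _-_; _*_; _≤_; -_)
open import Data.Nat using (ℕ)
open import Data.Product using (_×_)
open import Data.Sum using (_⊎_)
open import Relation.Nullary using (¬_)

-- Real numbers of the form (p + q·√5)/2 with p q ∈ ℤ (the field ℚ(√5)
-- restricted to what we need), represented exactly by the pair (p , q).
record Q√5/2 : Set where
  constructor _+_√5/2
  field
    p : ℤ
    q : ℤ

-- "t ≤ q·√5" for integers t, q, decided exactly via squaring.
LeSqrt5 : ℤ → ℤ → Set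
LeSqrt5 t q =
  ((t ≤ + 0) × (+ 0 ≤ q))
  ⊎ ((+ 0 ≤ q) × (t * t ≤ + 5 * (q * q)))
  ⊎ ((q ≤ + 0) × (t ≤ + 0) × (+ 5 * (q * q) ≤ t * t))

-- "a ≤ x" for an integer a and x = (p + q√5)/2 :  2a - p ≤ q√5
_≤ᵣ_ : ℤ → Q√5/2 → Set
a ≤ᵣ (p + q √5/2) = LeSqrt5 (+ 2 * a - p) q

IsFloor : ℤ → Q√5/2 → Set
IsFloor a x = (a ≤ᵣ x) × ¬ ((a + + 1) ≤ᵣ x)

-- φ = (1 + √5)/2
-- n·φ       = (n + n√5)/2
-- m·(φ + 1) = (3m + m√5)/2
-- n/φ       = n·(φ - 1) = (-n + n√5)/2     (since 1/φ = φ - 1)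
_·φ : ℕ → Q√5/2
n ·φ = (+ n) + (+ n) √5/2

_·[φ+1] : ℕ → Q√5/2
m ·[φ+1] = (+ 3 * + m) + (+ m) √5/2

_/φ : ℕ → Q√5/2
n /φ = (- (+ n)) + (+ n) √5/2

-- Work in ℤ[φ] = {u + vφ}, ordered as a subring of ℝ.  Put X = n/φ − m; then
-- nφ − (m + n) = X and nφ − mφ² = φ²X.  If a < m + n, then X < 0, while
-- mφ² < b + 1 ≤ a ≤ nφ says φ²X > 0.  If a > m + n, then X ≥ 1, while
-- mφ² ≥ b ≥ a − 2 ≥ m + n − 1 says 1 − φX ≥ 0; together φ ≤ 1.  Hence a = m + n,
-- and as n/φ = nφ − n, the floor of n/φ is a − n = m.
-- Since the order is only given by comparing squares, the real work is to show
-- that it is compatible with addition and with multiplication by φ.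
module Submission where

open import Defs
open import Data.Empty using (⊥-elim)
open import Data.List using (_∷_; [])
open import Data.Product using (_×_; _,_)
open import Data.Sum as Sum using (_⊎_; inj₁; inj₂)
open import Function using (_∘_; _⇔_; mk⇔; Equivalence)
open import Relation.Binary.PropositionalEquality
open import Relation.Nullary using (¬_)

open Equivalence using (to; from)

module SurdComparison where
  open import Data.Nat
  open import Data.Nat.Properties
  open import Data.Nat.Tactic.RingSolver

  infix 4 _√_≤_√_

  record _√_≤_√_ (x a y b : ℕ) : Set where
    constructor squares
    field squares-≤ : a * (x * x) ≤ b * (y * y)

  open _√_≤_√_ public

  m*m≤n*n⇒m≤n : ∀ {m n} → m * m ≤ n * n → m ≤ n
  m*m≤n*n⇒m≤n m*m≤n*n = ≮⇒≥ λ n<m → <⇒≱ (*-mono-< n<m n<m) m*m≤n*n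

  √≤√⇒≤ : ∀ {x y a} .{{_ : NonZero a}} → x √ a ≤ y √ a → x ≤ y
  √≤√⇒≤ {a = a} (squares h) = m*m≤n*n⇒m≤n (*-cancelˡ-≤ a h)

  √≤√-total : ∀ x a y b → x √ a ≤ y √ b ⊎ y √ b ≤ x √ a
  √≤√-total x a y b = Sum.map squares squares (≤-total (a * (x * x)) (b * (y * y)))

  √≤√-trans : ∀ {x y z a b c} → x √ a ≤ y √ b → y √ b ≤ z √ c → x √ a ≤ z √ c
  √≤√-trans (squares h) (squares h') = squares (≤-trans h h')

  √≤√-antimonoˡ : ∀ {x x' y a b} → x' ≤ x → x √ a ≤ y √ b → x' √ a ≤ y √ b
  √≤√-antimonoˡ {a = a} x'≤x (squares h) = squares (≤-trans (*-monoʳ-≤ a (*-mono-≤ x'≤x x'≤x)) h)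

  √≤√-monoʳ : ∀ {x y y' a b} → y ≤ y' → x √ a ≤ y √ b → x √ a ≤ y' √ b
  √≤√-monoʳ {b = b} y≤y' (squares h) = squares (≤-trans h (*-monoʳ-≤ b (*-mono-≤ y≤y' y≤y')))

  private
    square-+ : ∀ c z z' → c * ((z + z') * (z + z')) ≡ c * (z * z) + 2 * (c * (z * z')) + c * (z' * z')
    square-+ = solve-∀

    square-* : ∀ c z z' → (c * (z * z')) * (c * (z * z')) ≡ (c * (z * z)) * (c * (z' * z'))
    square-* = solve-∀

    cross-≤ : ∀ {x x' y y' a b} → x √ a ≤ y √ b → x' √ a ≤ y' √ b → a * (x * x') ≤ b * (y * y')
    cross-≤ {x} {x'} {y} {y'} {a} {b} (squares h) (squares h') = m*m≤n*n⇒m≤n (begin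
      (a * (x * x')) * (a * (x * x'))  ≡⟨ square-* a x x' ⟩
      (a * (x * x)) * (a * (x' * x'))  ≤⟨ *-mono-≤ h h' ⟩
      (b * (y * y)) * (b * (y' * y'))  ≡⟨ square-* b y y' ⟨
      (b * (y * y')) * (b * (y * y'))  ∎)
      where open ≤-Reasoning

  √≤√-+ : ∀ {x x' y y' a b} → x √ a ≤ y √ b → x' √ a ≤ y' √ b → x + x' √ a ≤ y + y' √ b
  √≤√-+ {x} {x'} {y} {y'} {a} {b} h h' = squares (begin
    a * ((x + x') * (x + x'))                         ≡⟨ square-+ a x x' ⟩
    a * (x * x) + 2 * (a * (x * x')) + a * (x' * x')
      ≤⟨ +-mono-≤ (+-mono-≤ (squares-≤ h) (*-monoʳ-≤ 2 (cross-≤ h h'))) (squares-≤ h') ⟩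
    b * (y * y) + 2 * (b * (y * y')) + b * (y' * y')  ≡⟨ square-+ b y y' ⟨
    b * ((y + y') * (y + y'))                         ∎)
    where open ≤-Reasoning

  √≤√-cancel : ∀ {x y d e a b} → x √ a ≤ y √ b → y + d √ b ≤ x + e √ a → d √ b ≤ e √ a
  √≤√-cancel {x} {y} {d} {e} {a} {b} h (squares h') = squares (≮⇒≥ λ ae²<bd² → <⇒≱ (begin-strict
    a * ((x + e) * (x + e))                        ≡⟨ square-+ a x e ⟩
    a * (x * x) + 2 * (a * (x * e)) + a * (e * e)
      <⟨ +-mono-≤-< (+-mono-≤ (squares-≤ h) (*-monoʳ-≤ 2 (cross-≤ h (squares (<⇒≤ ae²<bd²)))))
                    ae²<bd² ⟩
    b * (y * y) + 2 * (b * (y * d)) + b * (d * d)  ≡⟨ square-+ b y d ⟨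
    b * ((y + d) * (y + d))                        ∎) h')
    where open ≤-Reasoning

  private
    one-square : ∀ z → 5 * (1 * (z * z)) ≡ 5 * (z * z)
    one-square = solve-∀

    five-squares : ∀ z → 5 * (5 * (z * z)) ≡ 1 * (5 * z * (5 * z))
    five-squares = solve-∀

  √5*-below : ∀ {x y} → x √ 1 ≤ y √ 5 → x √ 5 ≤ 5 * y √ 1
  √5*-below {x} {y} (squares h) = squares (subst₂ _≤_ (one-square x) (five-squares y) (*-monoʳ-≤ 5 h))

  √5*-above : ∀ {x y} → y √ 5 ≤ x √ 1 → 5 * y √ 1 ≤ x √ 5
  √5*-above {x} {y} (squares h) = squares (subst₂ _≤_ (five-squares y) (one-square x) (*-monoʳ-≤ 5 h))

open SurdComparison
open import Data.Integer hiding (suc)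
open import Data.Integer.Properties
open import Data.Integer.Tactic.RingSolver
open import Data.Nat as ℕ using (ℕ; zero; suc; z≤n)
import Data.Nat.Properties as ℕ

+-√≤√ : ∀ {x a y b} → + a * (+ x * + x) ≤ + b * (+ y * + y) ⇔ x √ a ≤ y √ b
+-√≤√ {x} {a} {y} {b} = mk⇔ (λ h → squares (drop‿+≤+ (subst₂ _≤_ (embed a x) (embed b y) h)))
                             (λ h → subst₂ _≤_ (sym (embed a x)) (sym (embed b y)) (+≤+ (squares-≤ h)))
  where
  embed : ∀ c z → + c * (+ z * + z) ≡ + (c ℕ.* (z ℕ.* z))
  embed c z = trans (cong (+ c *_) (sym (pos-* z z))) (sym (pos-* c (z ℕ.* z)))

below⇔ : ∀ {T Q} → + T * + T ≤ + 5 * (+ Q * + Q) ⇔ T √ 1 ≤ Q √ 5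
below⇔ {T} {Q} = subst (λ l → l ≤ + 5 * (+ Q * + Q) ⇔ T √ 1 ≤ Q √ 5)
  (*-identityˡ (+ T * + T)) (+-√≤√ {T} {1} {Q} {5})

above⇔ : ∀ {T Q} → + 5 * (- + Q * - + Q) ≤ - + T * - + T ⇔ Q √ 5 ≤ T √ 1
above⇔ {T} {Q} = subst₂ (λ l r → l ≤ r ⇔ Q √ 5 ≤ T √ 1)
  (cong (+ 5 *_) (square-neg (+ Q))) (trans (*-identityˡ (+ T * + T)) (square-neg (+ T)))
  (+-√≤√ {Q} {5} {T} {1})
  where
  square-neg : ∀ i → i * i ≡ - i * - i
  square-neg = solve-∀

data LeSqrt5View : ℤ → ℤ → Set where
  nonpos∣nonneg : ∀ {t q} → t ≤ + 0 → + 0 ≤ q → LeSqrt5View t q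
  below : ∀ {T Q} → T √ 1 ≤ Q √ 5 → LeSqrt5View (+ T) (+ Q)
  above : ∀ {T Q} → Q √ 5 ≤ T √ 1 → LeSqrt5View (- + T) (- + Q)

toView : ∀ {t q} → LeSqrt5 t q → LeSqrt5View t q
toView (inj₁ (t≤0 , 0≤q)) = nonpos∣nonneg t≤0 0≤q
toView {+ T} {+ Q} (inj₂ (inj₁ (_ , h))) = below (to below⇔ h)
toView { -[1+ T ]} (inj₂ (inj₁ (0≤q , _))) = nonpos∣nonneg -≤+ 0≤q
toView {t} {+ Q} (inj₂ (inj₂ (_ , t≤0 , _))) = nonpos∣nonneg t≤0 (+≤+ z≤n)
toView {+ 0} { -[1+ Q ]} (inj₂ (inj₂ (_ , _ , h))) = above {0} (to above⇔ h)
toView { -[1+ T ]} { -[1+ Q ]} (inj₂ (inj₂ (_ , _ , h))) = above {suc T} (to above⇔ h)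
toView {+[1+ _ ]} { -[1+ _ ]} (inj₂ (inj₂ (_ , +≤+ () , _)))

fromView : ∀ {t q} → LeSqrt5View t q → LeSqrt5 t q
fromView (nonpos∣nonneg t≤0 0≤q) = inj₁ (t≤0 , 0≤q)
fromView (below h) = inj₂ (inj₁ (+≤+ z≤n , from below⇔ h))
fromView (above h) = inj₂ (inj₂ (neg-≤-pos , neg-≤-pos , from above⇔ h))

LeSqrt5-antimonoˡ : ∀ {t t' q} → t' ≤ t → LeSqrt5 t q → LeSqrt5 t' q
LeSqrt5-antimonoˡ t'≤t h = fromView (lower t'≤t (toView h))
  where
  lower-above : ∀ {T Q t'} → t' ≤ - + T → Q √ 5 ≤ T √ 1 → LeSqrt5View t' (- + Q)
  lower-above {zero} {t' = + _} (+≤+ z≤n) h = above {0} h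
  lower-above {T} {t' = -[1+ T' ]} t'≤t h =
    above {suc T'} (√≤√-monoʳ (drop‿+≤+ (neg-cancel-≤ {+ suc T'} {+ T} t'≤t)) h)

  lower : ∀ {t t' q} → t' ≤ t → LeSqrt5View t q → LeSqrt5View t' q
  lower t'≤t (nonpos∣nonneg t≤0 0≤q) = nonpos∣nonneg (≤-trans t'≤t t≤0) 0≤q
  lower -≤+ (below _) = nonpos∣nonneg -≤+ (+≤+ z≤n)
  lower (+≤+ T'≤T) (below h) = below (√≤√-antimonoˡ T'≤T h)
  lower t'≤t (above h) = lower-above t'≤t h

LeSqrt5-monoʳ : ∀ {t q q'} → q ≤ q' → LeSqrt5 t q → LeSqrt5 t q'
LeSqrt5-monoʳ q≤q' h = fromView (raise q≤q' (toView h))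
  where
  raise : ∀ {t q q'} → q ≤ q' → LeSqrt5View t q → LeSqrt5View t q'
  raise q≤q' (nonpos∣nonneg t≤0 0≤q) = nonpos∣nonneg t≤0 (≤-trans 0≤q q≤q')
  raise (+≤+ Q≤Q') (below h) = below (√≤√-monoʳ Q≤Q' h)
  raise {q' = + _} _ (above _) = nonpos∣nonneg neg-≤-pos (+≤+ z≤n)
  raise {q' = -[1+ Q' ]} q≤q' (above {Q = Q} h) =
    above {Q = suc Q'} (√≤√-antimonoˡ (drop‿+≤+ (neg-cancel-≤ {+ Q} {+ suc Q'} q≤q')) h)

LeSqrt5-weaken : ∀ {t q s r} → s ≤ + 0 → + 0 ≤ r → LeSqrt5 t q → LeSqrt5 (t + s) (q + r)
LeSqrt5-weaken {t} {q} {s} {r} s≤0 0≤r = LeSqrt5-monoʳ q≤q+r ∘ LeSqrt5-antimonoˡ t+s≤t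
  where
  t+s≤t : t + s ≤ t
  t+s≤t = ≤-trans (+-monoʳ-≤ t s≤0) (≤-reflexive (+-identityʳ t))

  q≤q+r : q ≤ q + r
  q≤q+r = ≤-trans (≤-reflexive (sym (+-identityʳ q))) (+-monoʳ-≤ q 0≤r)

private
  [x+y]-x≡y : ∀ x y → (x + y) - x ≡ y
  [x+y]-x≡y = solve-∀

  x-[x+y]≡-y : ∀ x y → x - (x + y) ≡ - y
  x-[x+y]≡-y = solve-∀

  LeSqrt5-below+above : ∀ {T Q T' Q'} → T √ 1 ≤ Q √ 5 → Q' √ 5 ≤ T' √ 1 →
                        LeSqrt5 (+ T - + T') (+ Q - + Q')
  LeSqrt5-below+above {T} {Q} {T'} {Q'} lo hi with ℕ.≤-total Q' Q
  -- If Q ≤ Q' then T ≤ Q√5 ≤ Q'√5 ≤ T', so both differences are nonpositive.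
  ... | inj₂ Q≤Q' with ℕ.m≤n⇒∃[o]m+o≡n Q≤Q'
                   | ℕ.m≤n⇒∃[o]m+o≡n (√≤√⇒≤ (√≤√-trans (√≤√-monoʳ Q≤Q' lo) hi))
  ...   | E , refl | D , refl = subst₂ LeSqrt5 (sym (x-[x+y]≡-y (+ T) (+ D))) (sym (x-[x+y]≡-y (+ Q) (+ E)))
                                  (fromView (above (√≤√-cancel lo hi)))
  LeSqrt5-below+above {T} {Q} {T'} {Q'} lo hi | inj₁ Q'≤Q with ℕ.≤-total T T'
  ... | inj₁ T≤T' = inj₁ (i≤j⇒i-j≤0 (+≤+ T≤T') , i≤j⇒0≤j-i (+≤+ Q'≤Q))
  ... | inj₂ T'≤T with ℕ.m≤n⇒∃[o]m+o≡n T'≤T | ℕ.m≤n⇒∃[o]m+o≡n Q'≤Q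
  ...   | D , refl | E , refl = subst₂ LeSqrt5 (sym ([x+y]-x≡y (+ T') (+ D))) (sym ([x+y]-x≡y (+ Q') (+ E)))
                                  (fromView (below (√≤√-cancel hi lo)))

LeSqrt5-+ : ∀ {t q t' q'} → LeSqrt5 t q → LeSqrt5 t' q' → LeSqrt5 (t + t') (q + q')
LeSqrt5-+ h h' = add (toView h) (toView h')
  where
  add : ∀ {t q t' q'} → LeSqrt5View t q → LeSqrt5View t' q' → LeSqrt5 (t + t') (q + q')
  add {t} {q} {t'} {q'} (nonpos∣nonneg t≤0 0≤q) v' =
    subst₂ LeSqrt5 (+-comm t' t) (+-comm q' q) (LeSqrt5-weaken t≤0 0≤q (fromView v'))
  add v (nonpos∣nonneg t'≤0 0≤q') = LeSqrt5-weaken t'≤0 0≤q' (fromView v)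
  add (below h) (below h') = fromView (below (√≤√-+ h h'))
  add (above {T} {Q} h) (above {T'} {Q'} h') =
    subst₂ LeSqrt5 (neg-distrib-+ (+ T) (+ T')) (neg-distrib-+ (+ Q) (+ Q')) (fromView (above (√≤√-+ h h')))
  add (below h) (above h') = LeSqrt5-below+above h h'
  add (above {T} {Q} h) (below {T'} {Q'} h') =
    subst₂ LeSqrt5 (+-comm (+ T') (- + T)) (+-comm (+ Q') (- + Q)) (LeSqrt5-below+above h' h)

LeSqrt5-√5* : ∀ {t q} → LeSqrt5 t q → LeSqrt5 (- (+ 5 * q)) (- t)
LeSqrt5-√5* h = scale (toView h)
  where
  -[5*-x]≡5*x : ∀ x → - (+ 5 * - x) ≡ + 5 * x
  -[5*-x]≡5*x = solve-∀

  scale : ∀ {t q} → LeSqrt5View t q → LeSqrt5 (- (+ 5 * q)) (- t)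
  scale (nonpos∣nonneg t≤0 0≤q) = inj₁ (neg-mono-≤ (*-monoˡ-≤-nonNeg (+ 5) 0≤q) , neg-mono-≤ t≤0)
  scale (below {T} {Q} h) =
    subst (λ t → LeSqrt5 t (- + T)) (cong -_ (pos-* 5 Q)) (fromView (above (√5*-below h)))
  scale (above {T} {Q} h) =
    subst₂ LeSqrt5 (trans (pos-* 5 Q) (sym (-[5*-x]≡5*x (+ Q)))) (sym (neg-involutive (+ T)))
      (fromView (below (√5*-above h)))

LeSqrt5-total : ∀ t q → LeSqrt5 t q ⊎ LeSqrt5 (- t) (- q)
LeSqrt5-total (+ T) (+ Q) = Sum.map (fromView ∘ below) (fromView ∘ above) (√≤√-total T 1 Q 5)
LeSqrt5-total (+ T) -[1+ Q ] = inj₂ (inj₁ (neg-≤-pos , +≤+ z≤n))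
LeSqrt5-total -[1+ T ] (+ Q) = inj₁ (inj₁ (-≤+ , +≤+ z≤n))
LeSqrt5-total -[1+ T ] -[1+ Q ] =
  Sum.swap (Sum.map (fromView ∘ below) (fromView ∘ above) (√≤√-total (suc T) 1 (suc Q) 5))

private
  halve : ∀ {i j} → + 2 * i ≤ + 2 * j → i ≤ j
  halve {i} {j} = *-cancelˡ-≤-pos i j (+ 2)

  square-2* : ∀ x → (+ 2 * x) * (+ 2 * x) ≡ + 4 * (x * x)
  square-2* = solve-∀

  5*square-2* : ∀ x → + 5 * ((+ 2 * x) * (+ 2 * x)) ≡ + 4 * (+ 5 * (x * x))
  5*square-2* = solve-∀

LeSqrt5-half : ∀ {t q} → LeSqrt5 (+ 2 * t) (+ 2 * q) → LeSqrt5 t q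
LeSqrt5-half (inj₁ (2t≤0 , 0≤2q)) = inj₁ (halve 2t≤0 , halve 0≤2q)
LeSqrt5-half {t} {q} (inj₂ (inj₁ (0≤2q , h))) =
  inj₂ (inj₁ (halve 0≤2q , *-cancelˡ-≤-pos _ _ (+ 4) (subst₂ _≤_ (square-2* t) (5*square-2* q) h)))
LeSqrt5-half {t} {q} (inj₂ (inj₂ (2q≤0 , 2t≤0 , h))) =
  inj₂ (inj₂ (halve 2q≤0 , halve 2t≤0 ,
               *-cancelˡ-≤-pos _ _ (+ 4) (subst₂ _≤_ (5*square-2* q) (square-2* t) h)))

infix 5 _+_φ

record ℤ[φ] : Set where
  constructor _+_φ
  field
    integral-part φ-coefficient : ℤ

-- u + vφ = ((2u + v) + v√5)/2
NonNeg : ℤ[φ] → Set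
NonNeg (u + v φ) = LeSqrt5 (- (+ 2 * u + v)) v

infixl 6 _+ᵩ_ _-ᵩ_
infix 8 -ᵩ_ φ*_

_+ᵩ_ : ℤ[φ] → ℤ[φ] → ℤ[φ]
(u + v φ) +ᵩ (u' + v' φ) = (u + u') + (v + v') φ

-ᵩ_ : ℤ[φ] → ℤ[φ]
-ᵩ (u + v φ) = (- u) + (- v) φ

_-ᵩ_ : ℤ[φ] → ℤ[φ] → ℤ[φ]
x -ᵩ y = x +ᵩ -ᵩ y

φ*_ : ℤ[φ] → ℤ[φ]
φ* (u + v φ) = v + (u + v) φ

fromℤ : ℤ → ℤ[φ]
fromℤ a = a + + 0 φ

NonNeg-+ : ∀ {x y} → NonNeg x → NonNeg y → NonNeg (x +ᵩ y)
NonNeg-+ {u + v φ} {u' + v' φ} h h' = subst (λ t → LeSqrt5 t (v + v')) (sum u v u' v') (LeSqrt5-+ h h')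
  where
  sum : ∀ u v u' v' → - (+ 2 * u + v) + - (+ 2 * u' + v') ≡ - (+ 2 * (u + u') + (v + v'))
  sum = solve-∀

-- 2·φx = x + √5·x
NonNeg-φ* : ∀ {x} → NonNeg x → NonNeg (φ* x)
NonNeg-φ* {u + v φ} h =
  LeSqrt5-half (subst₂ LeSqrt5 (integral u v) (irrational u v) (LeSqrt5-+ h (LeSqrt5-√5* h)))
  where
  integral : ∀ u v → - (+ 2 * u + v) + - (+ 5 * v) ≡ + 2 * - (+ 2 * v + (u + v))
  integral = solve-∀

  irrational : ∀ u v → v + - - (+ 2 * u + v) ≡ + 2 * (u + v)
  irrational = solve-∀

NonNeg-total : ∀ x → NonNeg x ⊎ NonNeg (-ᵩ x)
NonNeg-total (u + v φ) = Sum.map₂ (subst (λ t → LeSqrt5 t (- v)) (negate u v)) (LeSqrt5-total _ _)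
  where
  negate : ∀ u v → - - (+ 2 * u + v) ≡ - (+ 2 * - u + - v)
  negate = solve-∀

NonNeg-fromℤ : ∀ {a} → + 0 ≤ a → NonNeg (fromℤ a)
NonNeg-fromℤ 0≤a =
  inj₁ (neg-mono-≤ (subst (+ 0 ≤_) (sym (+-identityʳ _)) (*-monoˡ-≤-nonNeg (+ 2) 0≤a)) , +≤+ z≤n)

infix 4 _≤ᵩ_ _<ᵩ_

record _≤ᵩ_ (x y : ℤ[φ]) : Set where
  constructor nonneg
  field difference : NonNeg (y -ᵩ x)

_<ᵩ_ : ℤ[φ] → ℤ[φ] → Set
x <ᵩ y = ¬ (y ≤ᵩ x)

private
  telescope : ∀ a b c → (b - a) + (c - b) ≡ c - a
  telescope = solve-∀

  -[b-a]≡a-b : ∀ a b → - (b - a) ≡ a - b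
  -[b-a]≡a-b = solve-∀

≤ᵩ-trans : ∀ {x y z} → x ≤ᵩ y → y ≤ᵩ z → x ≤ᵩ z
≤ᵩ-trans {x@(u + v φ)} {y@(u' + v' φ)} {z@(u'' + v'' φ)} (nonneg x≤y) (nonneg y≤z) =
  nonneg (subst NonNeg (cong₂ _+_φ (telescope u u' u'') (telescope v v' v''))
                (NonNeg-+ {y -ᵩ x} {z -ᵩ y} x≤y y≤z))

≤ᵩ-total : ∀ x y → x ≤ᵩ y ⊎ y ≤ᵩ x
≤ᵩ-total x@(u + v φ) y@(u' + v' φ) with NonNeg-total (y -ᵩ x)
... | inj₁ x≤y = inj₁ (nonneg x≤y)
... | inj₂ y≤x = inj₂ (nonneg (subst NonNeg (cong₂ _+_φ (-[b-a]≡a-b u u') (-[b-a]≡a-b v v')) y≤x))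

<ᵩ⇒≤ᵩ : ∀ {x y} → x <ᵩ y → x ≤ᵩ y
<ᵩ⇒≤ᵩ {x} {y} x<y with ≤ᵩ-total x y
... | inj₁ x≤y = x≤y
... | inj₂ y≤x = ⊥-elim (x<y y≤x)

<ᵩ-≤ᵩ-trans : ∀ {x y z} → x <ᵩ y → y ≤ᵩ z → x <ᵩ z
<ᵩ-≤ᵩ-trans x<y y≤z z≤x = x<y (≤ᵩ-trans y≤z z≤x)

fromℤ-mono-≤ᵩ : ∀ {a b} → a ≤ b → fromℤ a ≤ᵩ fromℤ b
fromℤ-mono-≤ᵩ a≤b = nonneg (NonNeg-fromℤ (i≤j⇒0≤j-i a≤b))

1<φ : fromℤ (+ 1) <ᵩ + 0 + + 1 φ
1<φ (nonneg (inj₁ (_ , ())))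
1<φ (nonneg (inj₂ (inj₁ (() , _))))
1<φ (nonneg (inj₂ (inj₂ (_ , _ , +≤+ (ℕ.s≤s ())))))

⟦_⟧ : ℤ[φ] → Q√5/2
⟦ u + v φ ⟧ = (+ 2 * u + v) + v √5/2

≤ᵣ⇔≤ᵩ : ∀ {a x} → a ≤ᵣ ⟦ x ⟧ ⇔ fromℤ a ≤ᵩ x
≤ᵣ⇔≤ᵩ {a} {u + v φ} = mk⇔ (λ h → nonneg (subst₂ LeSqrt5 (shift a u v) (sym (+-identityʳ v)) h))
                            (λ where (nonneg h) → subst₂ LeSqrt5 (sym (shift a u v)) (+-identityʳ v) h)
  where
  shift : ∀ a u v → + 2 * a - (+ 2 * u + v) ≡ - (+ 2 * (u - a) + (v + + 0))
  shift = solve-∀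

IsFloor⇒bounds : ∀ {a x} → IsFloor a ⟦ x ⟧ → fromℤ a ≤ᵩ x × x <ᵩ fromℤ (a + + 1)
IsFloor⇒bounds (a≤x , x≱a+1) = to ≤ᵣ⇔≤ᵩ a≤x , x≱a+1 ∘ from ≤ᵣ⇔≤ᵩ

-- The equation says x − a = x' − a' for x = (p + q√5)/2 and x' = (p' + q√5)/2.
IsFloor-translate : ∀ {a a' p p' q} → + 2 * a - p ≡ + 2 * a' - p' →
                    IsFloor a (p + q √5/2) → IsFloor a' (p' + q √5/2)
IsFloor-translate {a} {a'} {p} {p'} {q} e (a≤x , x≱a+1) =
  subst (λ t → LeSqrt5 t q) e a≤x , x≱a+1 ∘ subst (λ t → LeSqrt5 t q) e-succ
  where
  e-succ : + 2 * (a' + + 1) - p' ≡ + 2 * (a + + 1) - p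
  e-succ = begin
    + 2 * (a' + + 1) - p'  ≡⟨ solve (a' ∷ p' ∷ []) ⟩
    + 2 * a' - p' + + 2    ≡⟨ cong (_+ + 2) e ⟨
    + 2 * a - p + + 2      ≡⟨ solve (a ∷ p ∷ []) ⟩
    + 2 * (a + + 1) - p    ∎
    where open ≡-Reasoning

-- (m + n) − nφ = m − n/φ, and φ² times it is mφ² − nφ.
nφ≤m+n⇒nφ≤mφ² : ∀ m n → + 0 + + n φ ≤ᵩ fromℤ (+ m + + n) → + 0 + + n φ ≤ᵩ + m + + m φ
nφ≤m+n⇒nφ≤mφ² m n (nonneg h) =
  nonneg (subst NonNeg (cong₂ _+_φ (e₁ (+ m) (+ n)) (e₂ (+ m) (+ n))) (NonNeg-φ* {φ* x} (NonNeg-φ* {x} h)))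
  where
  x : ℤ[φ]
  x = fromℤ (+ m + + n) -ᵩ (+ 0 + + n φ)

  e₁ : ∀ m n → (m + n - + 0) + (+ 0 - n) ≡ m - + 0
  e₁ = solve-∀

  e₂ : ∀ m n → (+ 0 - n) + ((m + n - + 0) + (+ 0 - n)) ≡ m - n
  e₂ = solve-∀

-- With X = n/φ − m:  nφ − (m + n + 1) = X − 1  and  mφ² − (m + n − 1) = 1 − φX.
m+n+1≤nφ⇒mφ²<m+n-1 : ∀ m n → fromℤ (+ m + + n + + 1) ≤ᵩ + 0 + + n φ →
                     + m + + m φ <ᵩ fromℤ (+ m + + n - + 1)
m+n+1≤nφ⇒mφ²<m+n-1 m n (nonneg h₁) (nonneg h₂) = 1<φ (nonneg
  (subst NonNeg (cong₂ _+_φ (e₁ (+ m) (+ n)) (e₂ (+ m) (+ n)))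
         (NonNeg-+ {φ* x₁} {x₂} (NonNeg-φ* {x₁} h₁) h₂)))
  where
  x₁ x₂ : ℤ[φ]
  x₁ = (+ 0 + + n φ) -ᵩ fromℤ (+ m + + n + + 1)
  x₂ = (+ m + + m φ) -ᵩ fromℤ (+ m + + n - + 1)

  e₁ : ∀ m n → (n - + 0) + (m - (m + n - + 1)) ≡ + 1 - + 0
  e₁ = solve-∀

  e₂ : ∀ m n → ((+ 0 - (m + n + + 1)) + (n - + 0)) + (m - + 0) ≡ + 0 - + 1
  e₂ = solve-∀

private
  i<j⇒i+1≤j : ∀ {i j} → i < j → i + + 1 ≤ j
  i<j⇒i+1≤j {i} {j} i<j = subst (_≤ j) (+-comm (+ 1) i) (i<j⇒suc[i]≤j i<j)

  i≤j-1⇒i+1≤j : ∀ {i j} → i ≤ j - + 1 → i + + 1 ≤ j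
  i≤j-1⇒i+1≤j {i} {j} i≤j-1 = subst (i + + 1 ≤_) (j-1+1≡j j) (+-monoˡ-≤ (+ 1) i≤j-1)
    where
    j-1+1≡j : ∀ j → j - + 1 + + 1 ≡ j
    j-1+1≡j = solve-∀

  i+1≤j⇒i-1≤j-2 : ∀ {i j} → i + + 1 ≤ j → i - + 1 ≤ j - + 2
  i+1≤j⇒i-1≤j-2 {i} {j} i+1≤j = subst (_≤ j - + 2) (i+1-2≡i-1 i) (+-monoˡ-≤ (- + 2) i+1≤j)
    where
    i+1-2≡i-1 : ∀ i → i + + 1 - + 2 ≡ i - + 1
    i+1-2≡i-1 = solve-∀

⟦mφ²⟧≡m·[φ+1] : ∀ m → ⟦ + m + + m φ ⟧ ≡ m ·[φ+1]
⟦mφ²⟧≡m·[φ+1] m = cong (λ p → p + + m √5/2) (2m+m≡3m (+ m))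
  where
  2m+m≡3m : ∀ m → + 2 * m + m ≡ + 3 * m
  2m+m≡3m = solve-∀

floor-nφ≡m+n : ∀ m n a b → fromℤ a ≤ᵩ + 0 + + n φ → + 0 + + n φ <ᵩ fromℤ (a + + 1) →
               fromℤ b ≤ᵩ + m + + m φ → + m + + m φ <ᵩ fromℤ (b + + 1) →
               a - + 2 ≤ b → b ≤ a - + 1 → a ≡ + m + + n
floor-nφ≡m+n m n a b a≤nφ nφ<a+1 b≤mφ² mφ²<b+1 a-2≤b b≤a-1 = ≤-antisym a≤m+n m+n≤a
  where
  mφ²<nφ : + m + + m φ <ᵩ + 0 + + n φ
  mφ²<nφ = <ᵩ-≤ᵩ-trans mφ²<b+1 (≤ᵩ-trans (fromℤ-mono-≤ᵩ (i≤j-1⇒i+1≤j b≤a-1)) a≤nφ)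

  m+n≤a : + m + + n ≤ a
  m+n≤a = ≮⇒≥ λ a<m+n → mφ²<nφ (nφ≤m+n⇒nφ≤mφ² m n
    (<ᵩ⇒≤ᵩ (<ᵩ-≤ᵩ-trans nφ<a+1 (fromℤ-mono-≤ᵩ (i<j⇒i+1≤j a<m+n)))))

  a≤m+n : a ≤ + m + + n
  a≤m+n = ≮⇒≥ λ m+n<a → m+n+1≤nφ⇒mφ²<m+n-1 m n
    (≤ᵩ-trans (fromℤ-mono-≤ᵩ (i<j⇒i+1≤j m+n<a)) a≤nφ)
    (≤ᵩ-trans (fromℤ-mono-≤ᵩ (≤-trans (i+1≤j⇒i-1≤j-2 {+ m + + n} (i<j⇒i+1≤j m+n<a)) a-2≤b))
              b≤mφ²)

lemma4p3 : (n m : ℕ) (a b : ℤ) → IsFloor a (n ·φ) → IsFloor b (m ·[φ+1])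
    → a - + 2 ≤ b → b ≤ a - + 1 → IsFloor (+ m) (n /φ)
lemma4p3 n m a b floor-a floor-b a-2≤b b≤a-1 =
  IsFloor-translate {a} {+ m} {+ n} { - + n} (2a-n≡2m+n a≡m+n) floor-a
  where
  a≡m+n : a ≡ + m + + n
  a≡m+n =
    let a≤nφ , nφ<a+1 = IsFloor⇒bounds {a} {+ 0 + + n φ} floor-a
        b≤mφ² , mφ²<b+1 =
          IsFloor⇒bounds {b} {+ m + + m φ} (subst (IsFloor b) (sym (⟦mφ²⟧≡m·[φ+1] m)) floor-b)
    in floor-nφ≡m+n m n a b a≤nφ nφ<a+1 b≤mφ² mφ²<b+1 a-2≤b b≤a-1

  2a-n≡2m+n : a ≡ + m + + n → + 2 * a - + n ≡ + 2 * + m - - + n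
  2a-n≡2m+n refl = shift (+ m) (+ n)
    where
    shift : ∀ m n → + 2 * (m + n) - n ≡ + 2 * m - - n
    shift = solve-∀
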